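{- Let $1\le r\le n$. For fixed integers $h\le k$ and a fixed tuple $s=(s_h,\dots,s_k)$ of integers, the assignment $M\mapsto F_{h,k}(M;s_h,\dots,s_k)$ on loopfree matroids $M$ of rank $r$ on $[n]$ induces a well-defined $\mathbb{Z}$-module homomorphism $\mathbb{M}_{r,n}\to\mathbb{Z}$.
   Context: $\mathbb{M}_{r,n}$: the free $\mathbb{Z}$-module on loopfree rank-$r$ matroids on $[n]$ modulo the kernel of the map $M\mapsto v_M\in\mathbb{Z}^{\mathfrak{C}_{r,n}}$, where $\mathfrak{C}_{r,n}$ is the set of chains $\emptyset\subsetneq F_1\subsetneq\dots\subsetneq F_r=[n]$ and $(v_M)_{\mathcal{C}}=1$ if $\mathcal{C}$ consists of flats of $M$, $0$ otherwise. $F_{h,k}(M;s_h,\dots,s_k)$ is the number of chains of flats $F_h\subsetneq\dots\subsetneq F_k$ of $M$ with $\mathrm{rank}_M(F_i)=i$ and $|F_i|=s_i$ for all $i=h,\dots,k$. -}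

module Defs where

open import Data.Bool using (Bool; true; false; if_then_else_)
import Data.Bool.Properties as BoolP
open import Data.Nat as ℕ using (ℕ; zero; suc; _≤_; _<_; _<?_)
open import Data.Integer as ℤ using (ℤ; +_; 0ℤ; 1ℤ)
open import Data.Fin using (Fin; toℕ; inject₁)
import Data.Fin.Properties as FinP
open import Data.Fin.Subset using (Subset; _⊆_; _∪_; _∩_; ⁅_⁆; ∣_∣; _∈_; _∉_; ⊥; ⊤; inside; outside)
open import Data.Fin.Subset.Properties using (_⊆?_; _∈?_)
open import Data.Vec using (Vec; []; _∷_; lookup)
open import Data.Vec.Properties using (≡-dec)
open import Data.List using (List; []; _∷_; map; _++_; concatMap; length; filter; foldr)
open import Data.Product using (_×_; _,_)
open import Data.Sum using (_⊎_)
open import Relation.Nullary using (¬_; Dec; yes; no)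
open import Relation.Nullary.Decidable using (⌊_⌋; _×-dec_; _⊎-dec_; ¬?)
open import Relation.Binary.PropositionalEquality using (_≡_)

record Matroid (n : ℕ) : Set where
  field
    rk        : Subset n → ℕ
    rk-bound  : ∀ A → rk A ≤ ∣ A ∣
    rk-mono   : ∀ {A B} → A ⊆ B → rk A ≤ rk B
    rk-submod : ∀ A B → rk (A ∪ B) ℕ.+ rk (A ∩ B) ≤ rk A ℕ.+ rk B
open Matroid public

IsFlat : ∀ {n} → Matroid n → Subset n → Set
IsFlat M F = ∀ x → x ∉ F → rk M F < rk M (F ∪ ⁅ x ⁆)

isFlat? : ∀ {n} (M : Matroid n) (F : Subset n) → Dec (IsFlat M F)
isFlat? M F = FinP.all? λ x → helper x
  where
  helper : ∀ x → Dec (x ∉ F → rk M F < rk M (F ∪ ⁅ x ⁆))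
  helper x with x ∈? F
  ... | yes x∈F = yes λ x∉F → Data.Empty.⊥-elim (x∉F x∈F)
    where import Data.Empty
  ... | no x∉F with rk M F <? rk M (F ∪ ⁅ x ⁆)
  ...   | yes p = yes λ _ → p
  ...   | no ¬p = no λ f → ¬p (f x∉F)

record LoopfreeMatroid (r n : ℕ) : Set where
  field
    matroid  : Matroid n
    loopfree : ∀ x → rk matroid ⁅ x ⁆ ≡ 1
    rank     : rk matroid ⊤ ≡ r
open LoopfreeMatroid public

_⊊_ : ∀ {n} → Subset n → Subset n → Set
A ⊊ B = A ⊆ B × ¬ (A ≡ B)

_⊊?_ : ∀ {n} (A B : Subset n) → Dec (A ⊊ B)
A ⊊? B = (A ⊆? B) ×-dec ¬? (≡-dec BoolP._≟_ A B)

-- 𝔠_{r,n}: chains ∅ ⊊ F₁ ⊊ … ⊊ F_r = [n]; F_{i+1} is C i for i : Fin r.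

IsChain : ∀ {r n} → (Fin r → Subset n) → Set
IsChain {r} C =
  (∀ i → toℕ i ≡ 0 → ⊥ ⊊ C i) ×
  (∀ i j → toℕ j ≡ suc (toℕ i) → C i ⊊ C j) ×
  (∀ i → suc (toℕ i) ≡ r → C i ≡ ⊤)

vM : ∀ {r n} → Matroid n → (Fin r → Subset n) → ℤ
vM M C = if ⌊ FinP.all? (λ i → isFlat? M (C i)) ⌋ then 1ℤ else 0ℤ

-- F_{h,k}(M; s_h,…,s_k) with k = h + ℓ, and the tuple (s_h,…,s_k)
-- given as s : Fin (suc ℓ) → ℤ, s j = s_{h+j}.

allSubsets : ∀ n → List (Subset n)
allSubsets zero    = [] ∷ []
allSubsets (suc n) = map (outside ∷_) (allSubsets n) ++ map (inside ∷_) (allSubsets n)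

allTuples : ∀ n m → List (Vec (Subset n) m)
allTuples n zero    = [] ∷ []
allTuples n (suc m) = concatMap (λ A → map (A ∷_) (allTuples n m)) (allSubsets n)

GoodChain : ∀ {n} → Matroid n → (h : ℤ) (ℓ : ℕ) → (Fin (suc ℓ) → ℤ)
          → Vec (Subset n) (suc ℓ) → Set
GoodChain M h ℓ s F =
  (∀ j → IsFlat M (lookup F j)
         × (+ rk M (lookup F j) ≡ h ℤ.+ + toℕ j)
         × (+ ∣ lookup F j ∣ ≡ s j)) ×
  (∀ (j : Fin ℓ) → lookup F (inject₁ j) ⊊ lookup F (Data.Fin.suc j))
  where import Data.Fin

goodChain? : ∀ {n} (M : Matroid n) h ℓ s F → Dec (GoodChain M h ℓ s F)
goodChain? M h ℓ s F =
  FinP.all? (λ j → isFlat? M (lookup F j)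
                   ×-dec (+ rk M (lookup F j) ℤ.≟ h ℤ.+ + toℕ j)
                   ×-dec (+ ∣ lookup F j ∣ ℤ.≟ s j))
  ×-dec FinP.all? (λ j → lookup F (inject₁ j) ⊊? lookup F (Data.Fin.suc j))
  where import Data.Fin

Fhk : ∀ {n} → Matroid n → (h : ℤ) (ℓ : ℕ) → (Fin (suc ℓ) → ℤ) → ℕ
Fhk {n} M h ℓ s = length (filter (goodChain? M h ℓ s) (allTuples n (suc ℓ)))

-- Finite ℤ-linear combinations Σ aᵢ Mᵢ of loopfree rank-r matroids.

Σℤ : ∀ {r n} → List (ℤ × LoopfreeMatroid r n) → (LoopfreeMatroid r n → ℤ) → ℤ
Σℤ xs f = foldr (λ { (a , M) acc → a ℤ.* f M ℤ.+ acc }) 0ℤ xs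

-- Every chain of flats F_h ⊊ ⋯ ⊊ F_k counted by F_{h,k}(M; s) has a
-- canonical completion to a maximal chain ∅ = F₀ ⊊ ⋯ ⊊ F_r = [n]: below h,
-- F_{j+1} is the flat covering F_j that contains the first element of F_h
-- missing from F_j; above k, likewise with [n] in place of F_h.  Whether a
-- maximal chain C of sets is canonical in this sense ("Canonical C") does
-- not depend on M, and a canonical C consisting of flats of M is the
-- completion of its own segment.  Hence
--     F_{h,k}(M; s) = Σ_{C canonical} (v_M)_C ,
-- a fixed integer combination of the coordinates of v_M, so every relation
-- Σ aᵢ v_{Mᵢ} = 0 yields Σ aᵢ F_{h,k}(Mᵢ; s) = 0.  (For h < 0 both sides
-- vanish trivially.)

module Submission where

open import Defs
open import Data.Nat using (ℕ; suc; _≤_)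
open import Data.Integer using (ℤ; +_; 0ℤ)
open import Data.Fin using (Fin)
open import Data.Fin.Subset using (Subset)
open import Data.List using (List)
open import Data.Product using (_×_)
open import Relation.Binary.PropositionalEquality using (_≡_)

import Level
open Level using (Level)
open import Data.Nat as ℕ using (zero; _<_; _≤?_; _<?_; z≤n; s≤s)
import Data.Nat.Properties as ℕP
open import Data.Integer as ℤ using (-[1+_]; 1ℤ)
import Data.Integer.Properties as ℤP
open import Data.Bool using (true; false; if_then_else_)
import Data.Bool.Properties as BoolP
open import Data.Fin using (zero; suc; toℕ; fromℕ<; inject₁)
import Data.Fin.Properties as FinP
open import Data.Fin.Subset
  using (_⊆_; _∪_; _∩_; ⁅_⁆; ∣_∣; _∈_; _∉_; ⊥; ⊤; ⋃; inside; outside)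
open import Data.Fin.Subset.Properties
  using (_∈?_; ⊆-antisym; ⊆⊤; ⊥⊆; ∈⊤; ∉⊥; ∣⊥∣≡0; ∣⁅x⁆∣≡1; x∈⁅x⁆; x∈⁅y⁆⇒x≡y;
         x∈p∪q⁻; p⊆p∪q; q⊆p∪q; x∈p∩q⁺; p∩q⊆p; p∩q⊆q)
open import Data.Maybe using (Maybe; just; nothing; maybe)
import Data.Maybe.Relation.Unary.All as Maybe
open import Data.List using ([]; _∷_; map; _++_; concatMap; length; filter; allFin)
import Data.List.Membership.Propositional as List
open import Data.List.Membership.Propositional.Properties using (∈-filter⁺; ∈-allFin)
open import Data.List.Relation.Unary.All as All using (All; []; _∷_)
open import Data.List.Relation.Unary.All.Properties using (all-filter)
open import Data.List.Relation.Unary.Any using (here; there)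
open import Data.Vec using (Vec; []; _∷_; lookup; tabulate)
import Data.Vec.Properties as VecP
open import Data.Product using (_,_; proj₁; proj₂)
open import Data.Sum using (inj₁; inj₂)
open import Relation.Nullary using (¬_; Dec; yes; no; does; contradiction)
open import Relation.Nullary.Decidable using (_×-dec_; _→-dec_; ⌊_⌋; ¬?; dec-true)
open import Relation.Binary.Definitions using (DecidableEquality)
open import Relation.Binary.PropositionalEquality
  using (_≢_; refl; sym; trans; cong; cong₂; subst; subst₂; module ≡-Reasoning)
open import Algebra.Properties.CommutativeSemigroup ℕP.+-commutativeSemigroup
  using () renaming (interchange to +-interchange)
open import Algebra.Properties.CommutativeSemigroup ℤP.+-commutativeSemigroup
  using () renaming (interchange to ℤ+-interchange)

private
  variable
    a b : Level
    A : Set a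
    B : Set b

ind : ∀ {p} {P : Set p} → Dec P → ℕ
ind (yes _) = 1
ind (no _)  = 0

ind-⇔ : ∀ {p q} {P : Set p} {Q : Set q} (d : Dec P) (e : Dec Q) → (P → Q) → (Q → P) → ind d ≡ ind e
ind-⇔ (yes _) (yes _) _ _ = refl
ind-⇔ (yes p) (no ¬q) f _ = contradiction (f p) ¬q
ind-⇔ (no ¬p) (yes q) _ g = contradiction (g q) ¬p
ind-⇔ (no _)  (no _)  _ _ = refl

ind-no : ∀ {p} {P : Set p} (d : Dec P) → ¬ P → ind d ≡ 0
ind-no (yes p) ¬p = contradiction p ¬p
ind-no (no _)  _  = refl

ind-× : ∀ {p q} {P : Set p} {Q : Set q} (d : Dec P) (e : Dec Q) → ind (d ×-dec e) ≡ ind d ℕ.* ind e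
ind-× (yes _) (yes _) = refl
ind-× (yes _) (no _)  = refl
ind-× (no _)  _       = refl

ind-yes-× : ∀ {p q} {P : Set p} {Q : Set q} (x : P) (e : Dec Q)
          → + ind (yes x ×-dec e) ≡ (if ⌊ e ⌋ then 1ℤ else 0ℤ)
ind-yes-× _ (yes _) = refl
ind-yes-× _ (no _)  = refl

∑ : List A → (A → ℕ) → ℕ
∑ []       f = 0
∑ (x ∷ xs) f = f x ℕ.+ ∑ xs f

syntax ∑ L (λ x → e) = ∑[ x ← L ] e

∑-cong : ∀ (L : List A) {f g : A → ℕ} → (∀ x → f x ≡ g x) → ∑ L f ≡ ∑ L g
∑-cong []      e = refl
∑-cong (x ∷ L) e = cong₂ ℕ._+_ (e x) (∑-cong L e)

∑-zero : ∀ (L : List A) {f : A → ℕ} → (∀ x → f x ≡ 0) → ∑ L f ≡ 0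
∑-zero []      e = refl
∑-zero (x ∷ L) e = cong₂ ℕ._+_ (e x) (∑-zero L e)

∑-+ : ∀ (L : List A) (f g : A → ℕ) → ∑[ x ← L ] (f x ℕ.+ g x) ≡ ∑ L f ℕ.+ ∑ L g
∑-+ []      f g = refl
∑-+ (x ∷ L) f g = trans (cong (f x ℕ.+ g x ℕ.+_) (∑-+ L f g))
                        (+-interchange (f x) (g x) (∑ L f) (∑ L g))

∑-*ˡ : ∀ (c : ℕ) (L : List A) (f : A → ℕ) → ∑[ x ← L ] (c ℕ.* f x) ≡ c ℕ.* ∑ L f
∑-*ˡ c []      f = sym (ℕP.*-zeroʳ c)
∑-*ˡ c (x ∷ L) f = trans (cong (c ℕ.* f x ℕ.+_) (∑-*ˡ c L f)) (sym (ℕP.*-distribˡ-+ c (f x) (∑ L f)))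

∑-++ : ∀ (L K : List A) (f : A → ℕ) → ∑ (L ++ K) f ≡ ∑ L f ℕ.+ ∑ K f
∑-++ []      K f = refl
∑-++ (x ∷ L) K f = trans (cong (f x ℕ.+_) (∑-++ L K f)) (sym (ℕP.+-assoc (f x) (∑ L f) (∑ K f)))

∑-swap : (L : List A) (K : List B) (f : A → B → ℕ)
       → ∑[ x ← L ] ∑ K (f x) ≡ ∑[ y ← K ] ∑[ x ← L ] f x y
∑-swap []      K f = sym (∑-zero K (λ _ → refl))
∑-swap (x ∷ L) K f = trans (cong (∑ K (f x) ℕ.+_) (∑-swap L K f))
                           (sym (∑-+ K (f x) (λ y → ∑[ x ← L ] f x y)))

∑-map : (L : List A) (g : A → B) (f : B → ℕ) → ∑ (map g L) f ≡ ∑[ x ← L ] f (g x)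
∑-map []      g f = refl
∑-map (x ∷ L) g f = cong (f (g x) ℕ.+_) (∑-map L g f)

∑-concatMap : (L : List A) (g : A → List B) (f : B → ℕ)
            → ∑ (concatMap g L) f ≡ ∑[ x ← L ] ∑ (g x) f
∑-concatMap []      g f = refl
∑-concatMap (x ∷ L) g f = trans (∑-++ (g x) (concatMap g L) f) (cong (∑ (g x) f ℕ.+_) (∑-concatMap L g f))

length-filter≡∑ : ∀ {p} {P : A → Set p} (P? : ∀ x → Dec (P x)) (L : List A)
                → length (filter P? L) ≡ ∑[ x ← L ] ind (P? x)
length-filter≡∑ P? []      = refl
length-filter≡∑ P? (x ∷ L) with P? x
... | yes _ = cong suc (length-filter≡∑ P? L)
... | no _  = length-filter≡∑ P? L

Enumerates : ∀ {a} {A : Set a} → DecidableEquality A → List A → Set a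
Enumerates _≟_ L = ∀ c → ∑[ x ← L ] ind (x ≟ c) ≡ 1

record Correspondence {a b p g} {A : Set a} {B : Set b} (P : B → Set p) (G : A → Set g)
       : Set (a Level.⊔ b Level.⊔ p Level.⊔ g) where
  field
    forth      : B → A
    back       : A → B
    forth-ok   : ∀ y → P y → G (forth y)
    back-ok    : ∀ x → G x → P (back x)
    forth-back : ∀ x → G x → forth (back x) ≡ x
    back-forth : ∀ y → P y → back (forth y) ≡ y

-- Each y with P y is counted once as the pair
-- (forth y , y) and each x with G x once as (x , back x); the two sets of
-- pairs coincide, so the double sums agree.
count-correspondence : ∀ {p g} {P : B → Set p} {G : A → Set g}
    (_≟A_ : DecidableEquality A) (_≟B_ : DecidableEquality B) (LA : List A) (LB : List B)
  → Enumerates _≟A_ LA → Enumerates _≟B_ LB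
  → (P? : ∀ y → Dec (P y)) (G? : ∀ x → Dec (G x)) → Correspondence P G
  → ∑[ y ← LB ] ind (P? y) ≡ ∑[ x ← LA ] ind (G? x)
count-correspondence {P = P} {G} _≟A_ _≟B_ LA LB enumA enumB P? G? corr = begin
  ∑[ y ← LB ] ind (P? y)                                         ≡⟨ ∑-cong LB (λ y → sym (pair-sumˡ y)) ⟩
  ∑[ y ← LB ] ∑[ x ← LA ] ind (P? y ×-dec (x ≟A forth y))         ≡⟨ ∑-swap LB LA _ ⟩
  ∑[ x ← LA ] ∑[ y ← LB ] ind (P? y ×-dec (x ≟A forth y))         ≡⟨ ∑-cong LA (λ x → ∑-cong LB (same-pairs x)) ⟩
  ∑[ x ← LA ] ∑[ y ← LB ] ind (G? x ×-dec (y ≟B back x))          ≡⟨ ∑-cong LA pair-sumʳ ⟩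
  ∑[ x ← LA ] ind (G? x)                                         ∎
  where
  open ≡-Reasoning
  open Correspondence corr

  pair-sumˡ : ∀ y → ∑[ x ← LA ] ind (P? y ×-dec (x ≟A forth y)) ≡ ind (P? y)
  pair-sumˡ y = begin
    ∑[ x ← LA ] ind (P? y ×-dec (x ≟A forth y))   ≡⟨ ∑-cong LA (λ x → ind-× (P? y) (x ≟A forth y)) ⟩
    ∑[ x ← LA ] (ind (P? y) ℕ.* ind (x ≟A forth y)) ≡⟨ ∑-*ˡ (ind (P? y)) LA _ ⟩
    ind (P? y) ℕ.* ∑[ x ← LA ] ind (x ≟A forth y)  ≡⟨ cong (ind (P? y) ℕ.*_) (enumA (forth y)) ⟩
    ind (P? y) ℕ.* 1                               ≡⟨ ℕP.*-identityʳ _ ⟩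
    ind (P? y)                                     ∎

  pair-sumʳ : ∀ x → ∑[ y ← LB ] ind (G? x ×-dec (y ≟B back x)) ≡ ind (G? x)
  pair-sumʳ x = begin
    ∑[ y ← LB ] ind (G? x ×-dec (y ≟B back x))     ≡⟨ ∑-cong LB (λ y → ind-× (G? x) (y ≟B back x)) ⟩
    ∑[ y ← LB ] (ind (G? x) ℕ.* ind (y ≟B back x))  ≡⟨ ∑-*ˡ (ind (G? x)) LB _ ⟩
    ind (G? x) ℕ.* ∑[ y ← LB ] ind (y ≟B back x)   ≡⟨ cong (ind (G? x) ℕ.*_) (enumB (back x)) ⟩
    ind (G? x) ℕ.* 1                               ≡⟨ ℕP.*-identityʳ _ ⟩
    ind (G? x)                                     ∎

  same-pairs : ∀ x y → ind (P? y ×-dec (x ≟A forth y)) ≡ ind (G? x ×-dec (y ≟B back x))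
  same-pairs x y = ind-⇔ _ _ to from
    where
    to : P y × x ≡ forth y → G x × y ≡ back x
    to (py , refl) = forth-ok y py , sym (back-forth y py)
    from : G x × y ≡ back x → P y × x ≡ forth y
    from (gx , refl) = back-ok x gx , sym (forth-back x gx)

∑-cons : ∀ {a m} {A : Set a} (_≟_ : DecidableEquality A) (a : A) (T : List (Vec A m)) (c : A) (cs : Vec A m)
  → ∑[ v ← map (a ∷_) T ] ind (VecP.≡-dec _≟_ v (c ∷ cs))
    ≡ ind (a ≟ c) ℕ.* ∑[ v ← T ] ind (VecP.≡-dec _≟_ v cs)
∑-cons {A = A} _≟_ a T c cs = begin
  ∑[ v ← map (a ∷_) T ] ind (v ≟ⱽ (c ∷ cs))      ≡⟨ ∑-map T (a ∷_) _ ⟩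
  ∑[ v ← T ] ind ((a ∷ v) ≟ⱽ (c ∷ cs))            ≡⟨ ∑-cong T split ⟩
  ∑[ v ← T ] (ind (a ≟ c) ℕ.* ind (v ≟ⱽ cs))      ≡⟨ ∑-*ˡ (ind (a ≟ c)) T _ ⟩
  ind (a ≟ c) ℕ.* ∑[ v ← T ] ind (v ≟ⱽ cs)        ∎
  where
  open ≡-Reasoning
  _≟ⱽ_ : ∀ {k} → DecidableEquality (Vec A k)
  _≟ⱽ_ = VecP.≡-dec _≟_
  split : ∀ v → ind ((a ∷ v) ≟ⱽ (c ∷ cs)) ≡ ind (a ≟ c) ℕ.* ind (v ≟ⱽ cs)
  split v = trans (ind-⇔ ((a ∷ v) ≟ⱽ (c ∷ cs)) ((a ≟ c) ×-dec (v ≟ⱽ cs))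
                         VecP.∷-injective (λ (p , q) → cong₂ _∷_ p q))
                  (ind-× (a ≟ c) (v ≟ⱽ cs))

_≟S_ : ∀ {n} → DecidableEquality (Subset n)
_≟S_ = VecP.≡-dec BoolP._≟_

_≟T_ : ∀ {n m} → DecidableEquality (Vec (Subset n) m)
_≟T_ = VecP.≡-dec _≟S_

allSubsets-enumerates : ∀ n → Enumerates _≟S_ (allSubsets n)
allSubsets-enumerates zero    []       = refl
allSubsets-enumerates (suc n) (b ∷ cs) = begin
  ∑ (map (outside ∷_) S ++ map (inside ∷_) S) count   ≡⟨ ∑-++ (map (outside ∷_) S) _ count ⟩
  ∑ (map (outside ∷_) S) count ℕ.+ ∑ (map (inside ∷_) S) count
      ≡⟨ cong₂ ℕ._+_ (∑-cons BoolP._≟_ outside S b cs) (∑-cons BoolP._≟_ inside S b cs) ⟩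
  ind (outside BoolP.≟ b) ℕ.* ∑ S countTail ℕ.+ ind (inside BoolP.≟ b) ℕ.* ∑ S countTail
      ≡⟨ cong (λ t → ind (outside BoolP.≟ b) ℕ.* t ℕ.+ ind (inside BoolP.≟ b) ℕ.* t) (allSubsets-enumerates n cs) ⟩
  ind (outside BoolP.≟ b) ℕ.* 1 ℕ.+ ind (inside BoolP.≟ b) ℕ.* 1   ≡⟨ exactly-one-side b ⟩
  1                                                   ∎
  where
  open ≡-Reasoning
  S = allSubsets n
  count = λ v → ind (v ≟S (b ∷ cs))
  countTail = λ v → ind (v ≟S cs)
  exactly-one-side : ∀ b → ind (outside BoolP.≟ b) ℕ.* 1 ℕ.+ ind (inside BoolP.≟ b) ℕ.* 1 ≡ 1
  exactly-one-side false = refl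
  exactly-one-side true  = refl

allTuples-enumerates : ∀ n m → Enumerates _≟T_ (allTuples n m)
allTuples-enumerates n zero    []       = refl
allTuples-enumerates n (suc m) (c ∷ cs) = begin
  ∑ (concatMap (λ A → map (A ∷_) T) S) count           ≡⟨ ∑-concatMap S _ count ⟩
  ∑[ A ← S ] ∑ (map (A ∷_) T) count                    ≡⟨ ∑-cong S headCount ⟩
  ∑[ A ← S ] ind (A ≟S c)                              ≡⟨ allSubsets-enumerates n c ⟩
  1                                                    ∎
  where
  open ≡-Reasoning
  S = allSubsets n
  T = allTuples n m
  count = λ v → ind (v ≟T (c ∷ cs))
  headCount : ∀ A → ∑ (map (A ∷_) T) count ≡ ind (A ≟S c)
  headCount A = begin
    ∑ (map (A ∷_) T) count                   ≡⟨ ∑-cons _≟S_ A T c cs ⟩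
    ind (A ≟S c) ℕ.* ∑[ v ← T ] ind (v ≟T cs) ≡⟨ cong (ind (A ≟S c) ℕ.*_) (allTuples-enumerates n m cs) ⟩
    ind (A ≟S c) ℕ.* 1                       ≡⟨ ℕP.*-identityʳ _ ⟩
    ind (A ≟S c)                             ∎

module _ {n : ℕ} where

  ∪-least : ∀ {A B C : Subset n} → A ⊆ C → B ⊆ C → A ∪ B ⊆ C
  ∪-least {A} {B} A⊆C B⊆C x∈A∪B with x∈p∪q⁻ A B x∈A∪B
  ... | inj₁ x∈A = A⊆C x∈A
  ... | inj₂ x∈B = B⊆C x∈B

  ∩-greatest : ∀ {A B C : Subset n} → C ⊆ A → C ⊆ B → C ⊆ A ∩ B
  ∩-greatest C⊆A C⊆B x∈C = x∈p∩q⁺ (C⊆A x∈C , C⊆B x∈C)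

  ⁅⁆⊆ : ∀ {x} {T : Subset n} → x ∈ T → ⁅ x ⁆ ⊆ T
  ⁅⁆⊆ {x} {T} x∈T y∈⁅x⁆ = subst (_∈ T) (sym (x∈⁅y⁆⇒x≡y x y∈⁅x⁆)) x∈T

  ∈-⋃⁅⁆ : ∀ {y : Fin n} ys → y List.∈ ys → y ∈ ⋃ (map ⁅_⁆ ys)
  ∈-⋃⁅⁆ (z ∷ ys) (here refl) = p⊆p∪q _ (x∈⁅x⁆ z)
  ∈-⋃⁅⁆ (z ∷ ys) (there y∈)  = q⊆p∪q ⁅ z ⁆ _ (∈-⋃⁅⁆ ys y∈)

  select : ∀ {P : Fin n → Set} → (∀ y → Dec (P y)) → Subset n
  select P? = tabulate (λ y → does (P? y))

  ∈-select⁻ : ∀ {P : Fin n → Set} (P? : ∀ y → Dec (P y)) {y} → y ∈ select P? → P y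
  ∈-select⁻ P? {y} y∈ = decided (P? y) (trans (sym (VecP.lookup∘tabulate _ y)) (VecP.[]=⇒lookup y∈))
    where
    decided : ∀ {Q : Set} (d : Dec Q) → does d ≡ true → Q
    decided (yes q) _ = q

  ∈-select⁺ : ∀ {P : Fin n → Set} (P? : ∀ y → Dec (P y)) {y} → P y → y ∈ select P?
  ∈-select⁺ P? {y} py = VecP.lookup⇒[]= y _ (trans (VecP.lookup∘tabulate _ y) (dec-true (P? y) py))

  firstNew : Subset n → Subset n → Maybe (Fin n)
  firstNew T S with FinP.any? (λ x → (x ∈? T) ×-dec ¬? (x ∈? S))
  ... | yes (x , _) = just x
  ... | no _        = nothing

  firstNew-just : ∀ T S {x} → firstNew T S ≡ just x → x ∈ T × x ∉ S
  firstNew-just T S eq with FinP.any? (λ x → (x ∈? T) ×-dec ¬? (x ∈? S))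
  firstNew-just T S refl | yes (_ , new) = new

  firstNew-nothing : ∀ T S → firstNew T S ≡ nothing → T ⊆ S
  firstNew-nothing T S eq {x} x∈T with FinP.any? (λ x → (x ∈? T) ×-dec ¬? (x ∈? S))
  firstNew-nothing T S refl {x} x∈T | no none with x ∈? S
  ... | yes x∈S = x∈S
  ... | no x∉S  = contradiction (x , x∈T , x∉S) none

  -- "A contains the first element of T missing from D": the rule by which
  -- a canonical chain of flats chooses its next member.
  Picks : Subset n → Subset n → Subset n → Set
  Picks T D A = Maybe.All (_∈ A) (firstNew T D)

  picks? : ∀ T D A → Dec (Picks T D A)
  picks? T D A = Maybe.dec (_∈? A) (firstNew T D)

  picks-cong : ∀ {T T′ D D′ A A′ : Subset n}
             → T ≡ T′ → D ≡ D′ → A ≡ A′ → Picks T′ D′ A′ → Picks T D A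
  picks-cong refl refl refl pick = pick

module FlatTheory {n : ℕ} (M : Matroid n) where

  R : Subset n → ℕ
  R = rk M

  submodular : ∀ A C {P Q} → P ⊆ A ∪ C → Q ⊆ A ∩ C → R P ℕ.+ R Q ≤ R A ℕ.+ R C
  submodular A C P⊆ Q⊆ = ℕP.≤-trans (ℕP.+-mono-≤ (rk-mono M P⊆) (rk-mono M Q⊆)) (rk-submod M A C)

  rk-add : ∀ A x → R (A ∪ ⁅ x ⁆) ≤ suc (R A)
  rk-add A x = begin
    R (A ∪ ⁅ x ⁆)                       ≤⟨ ℕP.m≤m+n _ _ ⟩
    R (A ∪ ⁅ x ⁆) ℕ.+ R (A ∩ ⁅ x ⁆)     ≤⟨ rk-submod M A ⁅ x ⁆ ⟩
    R A ℕ.+ R ⁅ x ⁆                     ≤⟨ ℕP.+-monoʳ-≤ (R A) (rk-bound M ⁅ x ⁆) ⟩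
    R A ℕ.+ ∣ ⁅ x ⁆ ∣                   ≡⟨ cong (R A ℕ.+_) (∣⁅x⁆∣≡1 x) ⟩
    R A ℕ.+ 1                           ≡⟨ ℕP.+-comm (R A) 1 ⟩
    suc (R A)                           ∎
    where open ℕP.≤-Reasoning

  flat-≡ : ∀ {A B} → IsFlat M A → A ⊆ B → R B ≤ R A → A ≡ B
  flat-≡ {A} {B} flatA A⊆B RB≤RA = ⊆-antisym A⊆B B⊆A
    where
    B⊆A : B ⊆ A
    B⊆A {y} y∈B with y ∈? A
    ... | yes y∈A = y∈A
    ... | no y∉A  = contradiction
        (ℕP.<-≤-trans (flatA y y∉A) (ℕP.≤-trans (rk-mono M (∪-least A⊆B (⁅⁆⊆ y∈B))) RB≤RA))
        (ℕP.n≮n (R A))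

  flat-⊊ : ∀ {A B} → IsFlat M A → A ⊊ B → R A < R B
  flat-⊊ flatA (A⊆B , A≢B) = ℕP.≰⇒> (λ RB≤RA → A≢B (flat-≡ flatA A⊆B RB≤RA))

  rk-<⇒⊈ : ∀ {T D} → R D < R T → ¬ (T ⊆ D)
  rk-<⇒⊈ RD<RT T⊆D = ℕP.<⇒≱ RD<RT (rk-mono M T⊆D)

  ⊤-flat : IsFlat M ⊤
  ⊤-flat x x∉⊤ = contradiction ∈⊤ x∉⊤

  -- An element raising the rank of a set raises the rank of each of its
  -- subsets (submodularity applied to F and I ∪ {x}).
  rk-jump-⊆ : ∀ {I F} x → I ⊆ F → R F < R (F ∪ ⁅ x ⁆) → R I < R (I ∪ ⁅ x ⁆)
  rk-jump-⊆ {I} {F} x I⊆F RF<RFx = ℕP.+-cancelˡ-< (R F) (R I) (R (I ∪ ⁅ x ⁆)) (begin-strict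
    R F ℕ.+ R I             <⟨ ℕP.+-monoˡ-< (R I) RF<RFx ⟩
    R (F ∪ ⁅ x ⁆) ℕ.+ R I   ≤⟨ submodular F (I ∪ ⁅ x ⁆) Fx⊆ (∩-greatest I⊆F (p⊆p∪q _)) ⟩
    R F ℕ.+ R (I ∪ ⁅ x ⁆)   ∎)
    where
    open ℕP.≤-Reasoning
    Fx⊆ : F ∪ ⁅ x ⁆ ⊆ F ∪ (I ∪ ⁅ x ⁆)
    Fx⊆ = ∪-least (p⊆p∪q _) (λ x∈ → q⊆p∪q F _ (q⊆p∪q I _ x∈))

  flat-∩ : ∀ {A B} → IsFlat M A → IsFlat M B → IsFlat M (A ∩ B)
  flat-∩ {A} {B} flatA flatB x x∉A∩B with x ∈? A | x ∈? B
  ... | yes x∈A | yes x∈B = contradiction (x∈p∩q⁺ (x∈A , x∈B)) x∉A∩B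
  ... | no x∉A  | _       = rk-jump-⊆ x (p∩q⊆p A B) (flatA x x∉A)
  ... | yes _   | no x∉B  = rk-jump-⊆ x (p∩q⊆q A B) (flatB x x∉B)

  Spans : Subset n → Fin n → Set
  Spans A y = R (A ∪ ⁅ y ⁆) ≤ R A

  spans? : ∀ A y → Dec (Spans A y)
  spans? A y = R (A ∪ ⁅ y ⁆) ≤? R A

  cl : Subset n → Subset n
  cl A = select (spans? A)

  cl-ext : ∀ A → A ⊆ cl A
  cl-ext A y∈A = ∈-select⁺ (spans? A) (rk-mono M (∪-least (λ z → z) (⁅⁆⊆ y∈A)))

  rk-absorb : ∀ A ys → All (Spans A) ys → R (A ∪ ⋃ (map ⁅_⁆ ys)) ≤ R A
  rk-absorb A []       []         = rk-mono M (∪-least (λ z → z) (λ z → contradiction z ∉⊥))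
  rk-absorb A (y ∷ ys) (Ry ∷ Rys) = ℕP.+-cancelʳ-≤ (R A) _ _ (begin
    R (A ∪ U′) ℕ.+ R A             ≤⟨ submodular (A ∪ U) (A ∪ ⁅ y ⁆) AU′⊆ (∩-greatest (p⊆p∪q _) (p⊆p∪q _)) ⟩
    R (A ∪ U) ℕ.+ R (A ∪ ⁅ y ⁆)    ≤⟨ ℕP.+-mono-≤ (rk-absorb A ys Rys) Ry ⟩
    R A ℕ.+ R A                    ∎)
    where
    open ℕP.≤-Reasoning
    U  = ⋃ (map ⁅_⁆ ys)
    U′ = ⁅ y ⁆ ∪ U
    AU′⊆ : A ∪ U′ ⊆ (A ∪ U) ∪ (A ∪ ⁅ y ⁆)
    AU′⊆ = ∪-least (λ z → p⊆p∪q _ (p⊆p∪q _ z))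
                   (∪-least (λ z → q⊆p∪q _ _ (q⊆p∪q A _ z)) (λ z → p⊆p∪q _ (q⊆p∪q A _ z)))

  -- Closing does not change the rank: cl A lies inside A together with the
  -- (finitely many) rank-preserving elements.
  cl-rk : ∀ A → R (cl A) ≡ R A
  cl-rk A = ℕP.≤-antisym (ℕP.≤-trans (rk-mono M clA⊆) (rk-absorb A ys spanned)) (rk-mono M (cl-ext A))
    where
    ys = filter (_∈? cl A) (allFin n)
    spanned : All (Spans A) ys
    spanned = All.map (∈-select⁻ (spans? A)) (all-filter (_∈? cl A) (allFin n))
    clA⊆ : cl A ⊆ A ∪ ⋃ (map ⁅_⁆ ys)
    clA⊆ {y} y∈ = q⊆p∪q A _ (∈-⋃⁅⁆ ys (∈-filter⁺ (_∈? cl A) (∈-allFin y) y∈))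

  -- The closure is a flat: an element outside cl A raises the rank of A,
  -- hence that of cl A, which has the same rank.
  cl-flat : ∀ A → IsFlat M (cl A)
  cl-flat A x x∉ = begin-strict
    R (cl A)            ≡⟨ cl-rk A ⟩
    R A                 <⟨ ℕP.≰⇒> (λ spans → x∉ (∈-select⁺ (spans? A) spans)) ⟩
    R (A ∪ ⁅ x ⁆)       ≤⟨ rk-mono M (∪-least (λ z → p⊆p∪q _ (cl-ext A z)) (q⊆p∪q _ _)) ⟩
    R (cl A ∪ ⁅ x ⁆)    ∎
    where open ℕP.≤-Reasoning

  cl-least : ∀ {A F} → IsFlat M F → A ⊆ F → cl A ⊆ F
  cl-least {A} {F} flatF A⊆F {y} y∈cl with y ∈? F
  ... | yes y∈F = y∈F
  ... | no y∉F  = contradiction (∈-select⁻ (spans? A) y∈cl) (ℕP.<⇒≱ (rk-jump-⊆ y A⊆F (flatF y y∉F)))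

  -- Two flats covering the same flat D (one rank above it) and sharing an
  -- element outside D coincide: their intersection is a flat strictly above
  -- D, so it has the full rank of each of them.
  cover-unique : ∀ {D A B x} → IsFlat M D → IsFlat M A → IsFlat M B → D ⊆ A → D ⊆ B
    → R A ≡ suc (R D) → R B ≡ suc (R D) → x ∈ A → x ∈ B → x ∉ D → A ≡ B
  cover-unique {D} {A} {B} {x} flatD flatA flatB D⊆A D⊆B RA RB x∈A x∈B x∉D =
    trans (sym (flat-≡ flatI (p∩q⊆p A B) (ℕP.≤-trans (ℕP.≤-reflexive RA) D<I)))
          (flat-≡ flatI (p∩q⊆q A B) (ℕP.≤-trans (ℕP.≤-reflexive RB) D<I))
    where
    flatI = flat-∩ flatA flatB
    D<I : R D < R (A ∩ B)
    D<I = ℕP.<-≤-trans (flatD x x∉D)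
            (rk-mono M (∪-least (∩-greatest D⊆A D⊆B) (⁅⁆⊆ (x∈p∩q⁺ (x∈A , x∈B)))))

  picks-unique : ∀ {T D A B} → IsFlat M D → IsFlat M A → IsFlat M B → D ⊆ A → D ⊆ B
    → R A ≡ suc (R D) → R B ≡ suc (R D) → ¬ (T ⊆ D) → Picks T D A → Picks T D B → A ≡ B
  picks-unique {T} {D} flatD flatA flatB D⊆A D⊆B RA RB T⊈D pickA pickB with firstNew T D in eq
  ... | nothing = contradiction (λ {y} → firstNew-nothing T D eq {y}) T⊈D
  ... | just x with Maybe.just x∈A ← pickA | Maybe.just x∈B ← pickB =
    cover-unique flatD flatA flatB D⊆A D⊆B RA RB x∈A x∈B (proj₂ (firstNew-just T D eq))

  step : Subset n → Subset n → Subset n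
  step T S = maybe (λ x → cl (S ∪ ⁅ x ⁆)) S (firstNew T S)

  record StepSpec (T S : Subset n) : Set where
    field
      isFlat : IsFlat M (step T S)
      rank   : R (step T S) ≡ suc (R S)
      above  : S ⊆ step T S
      below  : step T S ⊆ T
      picks  : Picks T S (step T S)

  step-spec : ∀ {T S} → IsFlat M T → IsFlat M S → S ⊆ T → R S < R T → StepSpec T S
  step-spec {T} {S} flatT flatS S⊆T RS<RT with firstNew T S in eq
  ... | nothing = contradiction (rk-mono M (λ {y} → firstNew-nothing T S eq {y})) (ℕP.<⇒≱ RS<RT)
  ... | just x  = record
    { isFlat = subst (IsFlat M) (sym next≡) (cl-flat (S ∪ ⁅ x ⁆))
    ; rank   = trans (cong R next≡) (trans (cl-rk (S ∪ ⁅ x ⁆)) (ℕP.≤-antisym (rk-add S x) (flatS x x∉S)))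
    ; above  = λ y∈S → subst (_ ∈_) (sym next≡) (cl-ext (S ∪ ⁅ x ⁆) (p⊆p∪q _ y∈S))
    ; below  = λ y∈ → cl-least flatT (∪-least S⊆T (⁅⁆⊆ x∈T)) (subst (_ ∈_) next≡ y∈)
    ; picks  = subst (Maybe.All (_∈ step T S)) (sym eq)
                 (Maybe.just (subst (x ∈_) (sym next≡) (cl-ext (S ∪ ⁅ x ⁆) (q⊆p∪q S _ (x∈⁅x⁆ x)))))
    }
    where
    next≡ : step T S ≡ cl (S ∪ ⁅ x ⁆)
    next≡ = cong (maybe (λ x → cl (S ∪ ⁅ x ⁆)) S) eq
    x∈T = proj₁ (firstNew-just T S eq)
    x∉S = proj₂ (firstNew-just T S eq)

  climb : Subset n → Subset n → ℕ → Subset n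
  climb T S zero    = S
  climb T S (suc j) = step T (climb T S j)

  module Climb {T S : Subset n} {ρ τ : ℕ} (flatT : IsFlat M T) (flatS : IsFlat M S) (S⊆T : S ⊆ T)
               (RS : R S ≡ ρ) (RT : R T ≡ τ) where

    record Stage (F : Subset n) (σ : ℕ) : Set where
      field
        isFlat : IsFlat M F
        rank   : R F ≡ σ
        below  : F ⊆ T

    stage : ∀ j → ρ ℕ.+ j ≤ τ → Stage (climb T S j) (ρ ℕ.+ j)
    stage-step : ∀ j → ρ ℕ.+ j < τ → StepSpec T (climb T S j)

    stage zero    _  = record { isFlat = flatS ; rank = trans RS (sym (ℕP.+-identityʳ ρ)) ; below = S⊆T }
    stage (suc j) le = record
      { isFlat = StepSpec.isFlat next
      ; rank   = trans (StepSpec.rank next) (trans (cong suc (Stage.rank (stage j (ℕP.<⇒≤ lt′)))) (sym (ℕP.+-suc ρ j)))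
      ; below  = StepSpec.below next
      }
      where
      lt′ = ℕP.<-≤-trans (ℕP.≤-reflexive (sym (ℕP.+-suc ρ j))) le
      next = stage-step j lt′

    stage-step j lt = step-spec flatT (Stage.isFlat current) (Stage.below current)
                        (subst₂ _<_ (sym (Stage.rank current)) (sym RT) lt)
      where current = stage j (ℕP.<⇒≤ lt)

    climb-end : ∀ d → ρ ℕ.+ d ≡ τ → climb T S d ≡ T
    climb-end d e = flat-≡ (Stage.isFlat last) (Stage.below last)
                      (ℕP.≤-reflexive (trans RT (trans (sym e) (sym (Stage.rank last)))))
      where last = stage d (ℕP.≤-reflexive e)

module LoopfreeTheory {r n : ℕ} (L : LoopfreeMatroid r n) where

  M : Matroid n
  M = matroid L

  open FlatTheory M public

  -- The empty set has rank 0, and it is a flat since singletons have rank 1.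
  rk-∅ : R ⊥ ≡ 0
  rk-∅ = ℕP.n≤0⇒n≡0 (ℕP.≤-trans (rk-bound M ⊥) (ℕP.≤-reflexive (∣⊥∣≡0 n)))

  ∅-flat : IsFlat M ⊥
  ∅-flat x _ = begin-strict
    R ⊥              ≡⟨ rk-∅ ⟩
    0                <⟨ ℕP.≤-refl ⟩
    1                ≡⟨ loopfree L x ⟨
    R ⁅ x ⁆          ≤⟨ rk-mono M (q⊆p∪q ⊥ _) ⟩
    R (⊥ ∪ ⁅ x ⁆)    ∎
    where open ℕP.≤-Reasoning

  rk≤r : ∀ A → R A ≤ r
  rk≤r A = ℕP.≤-trans (rk-mono M ⊆⊤) (ℕP.≤-reflexive (rank L))

  flat-rank-r : ∀ {F} → IsFlat M F → R F ≡ r → F ≡ ⊤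
  flat-rank-r flatF RF = flat-≡ flatF ⊆⊤ (ℕP.≤-reflexive (trans (rank L) (sym RF)))

-- A strictly increasing sequence g 0 < g 1 < ⋯ < g r of naturals with
-- g 0 = 0 and g r ≤ r has no room for gaps: g j = j for all j ≤ r.
-- (This is why the members of a maximal chain of flats have rank j.)
module StrictlyIncreasing (g : ℕ → ℕ) (r : ℕ) (increasing : ∀ j → j < r → g j < g (suc j)) where

  grows : ∀ j d → j ℕ.+ d ≤ r → g j ℕ.+ d ≤ g (j ℕ.+ d)
  grows j zero    _  = ℕP.≤-reflexive (trans (ℕP.+-identityʳ (g j)) (cong g (sym (ℕP.+-identityʳ j))))
  grows j (suc d) le = begin
    g j ℕ.+ suc d          ≡⟨ ℕP.+-suc (g j) d ⟩
    suc (g j ℕ.+ d)        ≤⟨ s≤s (grows j d (ℕP.<⇒≤ j+d<r)) ⟩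
    suc (g (j ℕ.+ d))      ≤⟨ increasing (j ℕ.+ d) j+d<r ⟩
    g (suc (j ℕ.+ d))      ≡⟨ cong g (ℕP.+-suc j d) ⟨
    g (j ℕ.+ suc d)        ∎
    where
    open ℕP.≤-Reasoning
    j+d<r : j ℕ.+ d < r
    j+d<r = ℕP.<-≤-trans (ℕP.≤-reflexive (sym (ℕP.+-suc j d))) le

  -- Reaching g j ≥ j requires j steps from g 0 = 0, and the r − j steps
  -- after it keep g j + (r − j) ≤ g r ≤ r.
  pinned : g 0 ≡ 0 → g r ≤ r → ∀ j → j ≤ r → g j ≡ j
  pinned g0 gr j j≤r = ℕP.≤-antisym upper lower
    where
    open ℕP.≤-Reasoning
    lower : j ≤ g j
    lower = subst (λ z → z ℕ.+ j ≤ g j) g0 (grows 0 j j≤r)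
    upper : g j ≤ j
    upper = ℕP.+-cancelʳ-≤ (r ℕ.∸ j) (g j) j (begin
      g j ℕ.+ (r ℕ.∸ j)       ≤⟨ grows j (r ℕ.∸ j) (ℕP.≤-reflexive (ℕP.m+[n∸m]≡n j≤r)) ⟩
      g (j ℕ.+ (r ℕ.∸ j))     ≡⟨ cong g (ℕP.m+[n∸m]≡n j≤r) ⟩
      g r                     ≤⟨ gr ⟩
      r                       ≡⟨ ℕP.m+[n∸m]≡n j≤r ⟨
      j ℕ.+ (r ℕ.∸ j)         ∎)

-- A maximal chain ∅ = F₀ ⊊ F₁ ⊊ ⋯ ⊊ F_r = [n] is stored as the vector
-- b = (F₁ , … , F_r); level b j is F_j (read as [n] beyond r).
module _ {r n : ℕ} where

  level : Vec (Subset n) r → ℕ → Subset n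
  level b zero    = ⊥
  level b (suc j) with j <? r
  ... | yes j<r = lookup b (fromℕ< j<r)
  ... | no _    = ⊤

  level-suc : ∀ b {j} (j<r : j < r) → level b (suc j) ≡ lookup b (fromℕ< j<r)
  level-suc b {j} j<r with j <? r
  ... | yes _   = refl
  ... | no j≮r  = contradiction j<r j≮r

  level-lookup : ∀ b (i : Fin r) → level b (suc (toℕ i)) ≡ lookup b i
  level-lookup b i = trans (level-suc b (FinP.toℕ<n i)) (cong (lookup b) (FinP.fromℕ<-toℕ i _))

module ChainOfFlats {r n : ℕ} (L : LoopfreeMatroid r n) {b : Vec (Subset n) r}
                    (chain : IsChain (lookup b)) (flats : ∀ i → IsFlat (matroid L) (lookup b i)) where

  open LoopfreeTheory L

  level-flat : ∀ j → j ≤ r → IsFlat M (level b j)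
  level-flat zero    _   = ∅-flat
  level-flat (suc j) j<r = subst (IsFlat M) (sym (level-suc b j<r)) (flats (fromℕ< j<r))

  level-⊊ : ∀ j → j < r → level b j ⊊ level b (suc j)
  level-⊊ zero    0<r    = subst (⊥ ⊊_) (sym (level-suc b 0<r)) (proj₁ chain (fromℕ< 0<r) (FinP.toℕ-fromℕ< 0<r))
  level-⊊ (suc j) 1+j<r = subst₂ _⊊_ (sym (level-suc b j<r)) (sym (level-suc b 1+j<r))
      (proj₁ (proj₂ chain) (fromℕ< j<r) (fromℕ< 1+j<r)
        (trans (FinP.toℕ-fromℕ< 1+j<r) (cong suc (sym (FinP.toℕ-fromℕ< j<r)))))
    where
    j<r : j < r
    j<r = ℕP.<-trans (ℕP.n<1+n j) 1+j<r

  level-rk : ∀ j → j ≤ r → R (level b j) ≡ j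
  level-rk = StrictlyIncreasing.pinned (λ j → R (level b j)) r
               (λ j j<r → flat-⊊ (level-flat j (ℕP.<⇒≤ j<r)) (level-⊊ j j<r))
               rk-∅ (rk≤r _)

module _ {r n : ℕ} (xs : List (ℤ × LoopfreeMatroid r n)) where

  Σℤ-cong : ∀ {f g : LoopfreeMatroid r n → ℤ} → (∀ L → f L ≡ g L) → Σℤ xs f ≡ Σℤ xs g
  Σℤ-cong {f} {g} f≗g = go xs
    where
    go : ∀ ys → Σℤ ys f ≡ Σℤ ys g
    go []             = refl
    go ((c , L) ∷ ys) = cong₂ (λ u v → c ℤ.* u ℤ.+ v) (f≗g L) (go ys)

  Σℤ-0 : Σℤ xs (λ _ → 0ℤ) ≡ 0ℤ
  Σℤ-0 = go xs
    where
    go : ∀ ys → Σℤ ys (λ _ → 0ℤ) ≡ 0ℤ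
    go []             = refl
    go ((c , _) ∷ ys) = cong₂ ℤ._+_ (ℤP.*-zeroʳ c) (go ys)

  Σℤ-+ : ∀ (f g : LoopfreeMatroid r n → ℤ) → Σℤ xs (λ L → f L ℤ.+ g L) ≡ Σℤ xs f ℤ.+ Σℤ xs g
  Σℤ-+ f g = go xs
    where
    go : ∀ ys → Σℤ ys (λ L → f L ℤ.+ g L) ≡ Σℤ ys f ℤ.+ Σℤ ys g
    go []             = refl
    go ((c , L) ∷ ys) = trans (cong₂ ℤ._+_ (ℤP.*-distribˡ-+ c (f L) (g L)) (go ys))
                              (ℤ+-interchange (c ℤ.* f L) (c ℤ.* g L) (Σℤ ys f) (Σℤ ys g))

  Σℤ-∑ : ∀ {b} {B : Set b} (K : List B) (f : B → LoopfreeMatroid r n → ℕ)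
       → (∀ y → Σℤ xs (λ L → + f y L) ≡ 0ℤ) → Σℤ xs (λ L → + ∑[ y ← K ] f y L) ≡ 0ℤ
  Σℤ-∑ []      f each = Σℤ-0
  Σℤ-∑ (y ∷ K) f each = trans (Σℤ-+ (λ L → + f y L) (λ L → + ∑[ y ← K ] f y L))
                              (cong₂ ℤ._+_ (each y) (Σℤ-∑ K f each))

isChain? : ∀ {r n} (C : Fin r → Subset n) → Dec (IsChain C)
isChain? {r} C =
        FinP.all? (λ i → (toℕ i ℕP.≟ 0) →-dec (⊥ ⊊? C i))
  ×-dec FinP.all? (λ i → FinP.all? (λ j → (toℕ j ℕP.≟ suc (toℕ i)) →-dec (C i ⊊? C j)))
  ×-dec FinP.all? (λ i → (suc (toℕ i) ℕP.≟ r) →-dec (C i ≟S ⊤))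

module CanonicalChains (r n h ℓ : ℕ) (s : Fin (suc ℓ) → ℤ) where

  k : ℕ
  k = h ℕ.+ ℓ

  restrict : Vec (Subset n) r → Vec (Subset n) (suc ℓ)
  restrict b = tabulate (λ j → level b (h ℕ.+ toℕ j))

  restrict-lookup : ∀ b j → lookup (restrict b) j ≡ level b (h ℕ.+ toℕ j)
  restrict-lookup b = VecP.lookup∘tabulate (λ j → level b (h ℕ.+ toℕ j))

  same-segment : ∀ {b b′} → restrict b ≡ restrict b′
               → ∀ i → i ≤ ℓ → level b (h ℕ.+ i) ≡ level b′ (h ℕ.+ i)
  same-segment {b} {b′} same i i≤ℓ = begin
    level b (h ℕ.+ i)           ≡⟨ cong (λ t → level b (h ℕ.+ t)) (FinP.toℕ-fromℕ< (s≤s i≤ℓ)) ⟨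
    level b (h ℕ.+ toℕ j)       ≡⟨ restrict-lookup b j ⟨
    lookup (restrict b) j       ≡⟨ cong (λ v → lookup v j) same ⟩
    lookup (restrict b′) j      ≡⟨ restrict-lookup b′ j ⟩
    level b′ (h ℕ.+ toℕ j)      ≡⟨ cong (λ t → level b′ (h ℕ.+ t)) (FinP.toℕ-fromℕ< (s≤s i≤ℓ)) ⟩
    level b′ (h ℕ.+ i)          ∎
    where
    open ≡-Reasoning
    j = fromℕ< (s≤s i≤ℓ)

  HasSizes : Vec (Subset n) r → Set
  HasSizes b = ∀ j → + ∣ level b (h ℕ.+ toℕ j) ∣ ≡ s j

  CanonicalAt : Vec (Subset n) r → ℕ → Set
  CanonicalAt b j = (j < h → Picks (level b h) (level b j) (level b (suc j)))
                  × (k ≤ j → Picks ⊤ (level b j) (level b (suc j)))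

  -- A maximal chain whose segment from h to k has sizes s and which follows
  -- the canonical rule outside that segment.  No matroid is involved.
  Canonical : Vec (Subset n) r → Set
  Canonical b = k ≤ r × IsChain (lookup b) × HasSizes b × (∀ (j : Fin r) → CanonicalAt b (toℕ j))

  canonical? : ∀ b → Dec (Canonical b)
  canonical? b = (k ≤? r) ×-dec isChain? (lookup b)
    ×-dec FinP.all? (λ j → + ∣ level b (h ℕ.+ toℕ j) ∣ ℤP.≟ s j)
    ×-dec FinP.all? (λ j → ((toℕ j <? h) →-dec picks? (level b h) (level b (toℕ j)) (level b (suc (toℕ j))))
                     ×-dec ((k ≤? toℕ j) →-dec picks? ⊤ (level b (toℕ j)) (level b (suc (toℕ j)))))

  canonical-at : ∀ {b} → Canonical b → ∀ j → j < r → CanonicalAt b j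
  canonical-at {b} (_ , _ , _ , canon) j j<r = subst (CanonicalAt b) (FinP.toℕ-fromℕ< j<r) (canon (fromℕ< j<r))

  module InMatroid (L : LoopfreeMatroid r n) where

    open LoopfreeTheory L

    CanonicalFlag : Vec (Subset n) r → Set
    CanonicalFlag b = Canonical b × (∀ i → IsFlat M (lookup b i))

    -- (Its decision is the one that vM tests, conjoined with canonicity.)
    canonicalFlag? : ∀ b → Dec (CanonicalFlag b)
    canonicalFlag? b = canonical? b ×-dec FinP.all? (λ i → isFlat? M (lookup b i))

    restrict-good : ∀ {b} → CanonicalFlag b → GoodChain M (+ h) ℓ s (restrict b)
    restrict-good {b} ((k≤r , chain , sizes , _) , flats) = members , increasing
      where
      open ChainOfFlats L {b} chain flats
      members : ∀ j → IsFlat M (lookup (restrict b) j)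
                      × (+ R (lookup (restrict b) j) ≡ + h ℤ.+ + toℕ j)
                      × (+ ∣ lookup (restrict b) j ∣ ≡ s j)
      members j = subst (λ U → IsFlat M U × (+ R U ≡ + (h ℕ.+ toℕ j)) × (+ ∣ U ∣ ≡ s j))
                        (sym (restrict-lookup b j))
                        (level-flat _ h+j≤r , cong +_ (level-rk _ h+j≤r) , sizes j)
        where
        h+j≤r : h ℕ.+ toℕ j ≤ r
        h+j≤r = ℕP.≤-trans (ℕP.+-monoʳ-≤ h (ℕP.≤-pred (FinP.toℕ<n j))) k≤r
      increasing : ∀ (j : Fin ℓ) → lookup (restrict b) (inject₁ j) ⊊ lookup (restrict b) (suc j)
      increasing j = subst₂ _⊊_
          (sym (trans (restrict-lookup b (inject₁ j)) (cong (λ i → level b (h ℕ.+ i)) (FinP.toℕ-inject₁ j))))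
          (sym (trans (restrict-lookup b (suc j)) (cong (level b) (ℕP.+-suc h (toℕ j)))))
          (level-⊊ (h ℕ.+ toℕ j) h+j<r)
        where
        h+j<r : h ℕ.+ toℕ j < r
        h+j<r = ℕP.<-≤-trans (ℕP.≤-reflexive (sym (ℕP.+-suc h _))) (ℕP.≤-trans (ℕP.+-monoʳ-≤ h (FinP.toℕ<n j)) k≤r)

    -- A canonical flag is determined by its segment: below h and from k on,
    -- each next member is the flat covering the previous one that contains
    -- the element prescribed by the canonical rule (picks-unique).
    canonical-unique : ∀ {b b′} → CanonicalFlag b → CanonicalFlag b′ → restrict b ≡ restrict b′ → b ≡ b′
    canonical-unique {b} {b′} (cb@(k≤r , chain , _) , flats) (cb′@(_ , chain′ , _) , flats′) same = begin
      b                       ≡⟨ VecP.tabulate∘lookup b ⟨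
      tabulate (lookup b)     ≡⟨ VecP.tabulate-cong same-member ⟩
      tabulate (lookup b′)    ≡⟨ VecP.tabulate∘lookup b′ ⟩
      b′                      ∎
      where
      open ≡-Reasoning
      module F  = ChainOfFlats L {b} chain flats
      module F′ = ChainOfFlats L {b′} chain′ flats′

      h≤r : h ≤ r
      h≤r = ℕP.≤-trans (ℕP.m≤m+n h ℓ) k≤r

      same-next : ∀ j (j<r : j < r) T → level b j ≡ level b′ j → R (level b j) < R T
        → Picks T (level b j) (level b (suc j)) → Picks T (level b′ j) (level b′ (suc j))
        → level b (suc j) ≡ level b′ (suc j)
      same-next j j<r T eq RD<RT pick pick′ =
        picks-unique (F.level-flat j j≤r) (F.level-flat (suc j) j<r) (F′.level-flat (suc j) j<r)
          (proj₁ (F.level-⊊ j j<r)) (subst (_⊆ level b′ (suc j)) (sym eq) (proj₁ (F′.level-⊊ j j<r)))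
          (trans (F.level-rk (suc j) j<r) (cong suc (sym (F.level-rk j j≤r))))
          (trans (F′.level-rk (suc j) j<r) (cong suc (sym (trans (cong R eq) (F′.level-rk j j≤r)))))
          (rk-<⇒⊈ RD<RT) pick (subst (λ D → Picks T D (level b′ (suc j))) (sym eq) pick′)
        where j≤r = ℕP.<⇒≤ j<r

      same-levels : ∀ j → j ≤ r → level b j ≡ level b′ j
      same-levels zero    _   = refl
      same-levels (suc j) j<r with j <? h
      ... | yes j<h = same-next j j<r (level b h) (same-levels j (ℕP.<⇒≤ j<r))
          (subst₂ _<_ (sym (F.level-rk j (ℕP.<⇒≤ j<r))) (sym (F.level-rk h h≤r)) j<h)
          (proj₁ (canonical-at cb j j<r) j<h)
          (subst (λ T → Picks T (level b′ j) (level b′ (suc j))) (sym same-h) (proj₁ (canonical-at cb′ j j<r) j<h))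
        where
        same-h : level b h ≡ level b′ h
        same-h = subst (λ t → level b t ≡ level b′ t) (ℕP.+-identityʳ h) (same-segment same 0 z≤n)
      ... | no j≮h with suc j ≤? k
      ...   | yes 1+j≤k = subst (λ t → level b t ≡ level b′ t) (ℕP.m+[n∸m]≡n h≤1+j)
                            (same-segment same (suc j ℕ.∸ h) (ℕP.m≤n+o⇒m∸n≤o (suc j) h 1+j≤k))
        where h≤1+j = ℕP.m≤n⇒m≤1+n (ℕP.≮⇒≥ j≮h)
      ...   | no 1+j≰k = same-next j j<r ⊤ (same-levels j (ℕP.<⇒≤ j<r))
          (subst₂ _<_ (sym (F.level-rk j (ℕP.<⇒≤ j<r))) (sym (rank L)) j<r)
          (proj₂ (canonical-at cb j j<r) k≤j) (proj₂ (canonical-at cb′ j j<r) k≤j)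
        where k≤j = ℕP.≤-pred (ℕP.≰⇒> 1+j≰k)

      same-member : ∀ i → lookup b i ≡ lookup b′ i
      same-member i = trans (sym (level-lookup b i)) (trans (same-levels (suc (toℕ i)) (FinP.toℕ<n i)) (level-lookup b′ i))

    module Completion (a : Vec (Subset n) (suc ℓ)) where

      -- G i is the member G_i of a (read as [n] beyond ℓ).
      G : ℕ → Subset n
      G i with i <? suc ℓ
      ... | yes i≤ℓ = lookup a (fromℕ< i≤ℓ)
      ... | no _    = ⊤

      completion : ℕ → Subset n
      completion j with j <? h
      ... | yes _ = climb (G 0) ⊥ j
      ... | no _ with j ≤? k
      ...   | yes _ = G (j ℕ.∸ h)
      ...   | no _  = climb ⊤ (G ℓ) (j ℕ.∸ k)

      complete : Vec (Subset n) r
      complete = tabulate (λ i → completion (suc (toℕ i)))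

    module CompletionSpec {a : Vec (Subset n) (suc ℓ)} (good : GoodChain M (+ h) ℓ s a) where

      open Completion a

      G-at : ∀ {i} (i≤ℓ : i ≤ ℓ) → G i ≡ lookup a (fromℕ< (s≤s i≤ℓ))
      G-at {i} i≤ℓ with i <? suc ℓ
      ... | yes _   = refl
      ... | no i≰ℓ  = contradiction (s≤s i≤ℓ) i≰ℓ

      G-lookup : ∀ j → G (toℕ j) ≡ lookup a j
      G-lookup j = trans (G-at (ℕP.≤-pred (FinP.toℕ<n j))) (cong (lookup a) (FinP.fromℕ<-toℕ j _))

      G-flat : ∀ i → i ≤ ℓ → IsFlat M (G i)
      G-flat i i≤ℓ = subst (IsFlat M) (sym (G-at i≤ℓ)) (proj₁ (proj₁ good (fromℕ< (s≤s i≤ℓ))))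

      G-rk : ∀ i → i ≤ ℓ → R (G i) ≡ h ℕ.+ i
      G-rk i i≤ℓ = begin
        R (G i)                                  ≡⟨ cong R (G-at i≤ℓ) ⟩
        R (lookup a j)                           ≡⟨ ℤP.+-injective (proj₁ (proj₂ (proj₁ good j))) ⟩
        h ℕ.+ toℕ j                              ≡⟨ cong (h ℕ.+_) (FinP.toℕ-fromℕ< (s≤s i≤ℓ)) ⟩
        h ℕ.+ i                                  ∎
        where
        open ≡-Reasoning
        j = fromℕ< (s≤s i≤ℓ)

      G-⊊ : ∀ i → i < ℓ → G i ⊊ G (suc i)
      G-⊊ i i<ℓ = subst₂ _⊊_
          (trans (sym (G-lookup (inject₁ j))) (cong G (trans (FinP.toℕ-inject₁ j) (FinP.toℕ-fromℕ< i<ℓ))))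
          (trans (sym (G-lookup (suc j))) (cong (λ t → G (suc t)) (FinP.toℕ-fromℕ< i<ℓ)))
          (proj₂ good j)
        where j = fromℕ< i<ℓ

      -- Rank h + ℓ occurs in M, so the segment fits below rank r.
      k≤r : k ≤ r
      k≤r = subst (_≤ r) (G-rk ℓ ℕP.≤-refl) (rk≤r (G ℓ))

      module Low = Climb (G-flat 0 z≤n) ∅-flat ⊥⊆ rk-∅ (trans (G-rk 0 z≤n) (ℕP.+-identityʳ h))
      module Up  = Climb ⊤-flat (G-flat ℓ ℕP.≤-refl) ⊆⊤ (G-rk ℓ ℕP.≤-refl) (rank L)

      -- The completion in each of its three ranges; at the boundaries the
      -- lower climb has arrived at G₀ and the upper one starts at G_ℓ.
      completion-low : ∀ j → j ≤ h → completion j ≡ climb (G 0) ⊥ j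
      completion-low j j≤h with j <? h
      ... | yes _ = refl
      ... | no j≮h with j ≤? k
      ...   | yes _ = begin
                G (j ℕ.∸ h)           ≡⟨ cong (λ t → G (t ℕ.∸ h)) j≡h ⟩
                G (h ℕ.∸ h)           ≡⟨ cong G (ℕP.n∸n≡0 h) ⟩
                G 0                   ≡⟨ Low.climb-end h refl ⟨
                climb (G 0) ⊥ h       ≡⟨ cong (climb (G 0) ⊥) j≡h ⟨
                climb (G 0) ⊥ j       ∎
        where
        open ≡-Reasoning
        j≡h = ℕP.≤-antisym j≤h (ℕP.≮⇒≥ j≮h)
      ...   | no j≰k = contradiction (ℕP.≤-trans j≤h (ℕP.m≤m+n h ℓ)) j≰k

      completion-mid : ∀ j → h ≤ j → j ≤ k → completion j ≡ G (j ℕ.∸ h)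
      completion-mid j h≤j j≤k with j <? h
      ... | yes j<h = contradiction h≤j (ℕP.<⇒≱ j<h)
      ... | no _ with j ≤? k
      ...   | yes _  = refl
      ...   | no j≰k = contradiction j≤k j≰k

      completion-up : ∀ j → k ≤ j → completion j ≡ climb ⊤ (G ℓ) (j ℕ.∸ k)
      completion-up j k≤j with j <? h
      ... | yes j<h = contradiction (ℕP.≤-trans (ℕP.m≤m+n h ℓ) k≤j) (ℕP.<⇒≱ j<h)
      ... | no _ with j ≤? k
      ...   | yes j≤k = begin
                G (j ℕ.∸ h)                  ≡⟨ cong (λ t → G (t ℕ.∸ h)) j≡k ⟩
                G (k ℕ.∸ h)                  ≡⟨ cong G (ℕP.m+n∸m≡n h ℓ) ⟩
                climb ⊤ (G ℓ) 0              ≡⟨ cong (climb ⊤ (G ℓ)) (ℕP.n∸n≡0 k) ⟨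
                climb ⊤ (G ℓ) (k ℕ.∸ k)      ≡⟨ cong (λ t → climb ⊤ (G ℓ) (t ℕ.∸ k)) j≡k ⟨
                climb ⊤ (G ℓ) (j ℕ.∸ k)      ∎
        where
        open ≡-Reasoning
        j≡k = ℕP.≤-antisym j≤k k≤j
      ...   | no _ = refl

      completion-flat : ∀ j → j ≤ r → IsFlat M (completion j) × R (completion j) ≡ j
      completion-flat j j≤r with j ≤? h
      ... | yes j≤h = subst (λ F → IsFlat M F × R F ≡ j) (sym (completion-low j j≤h))
                        (Low.Stage.isFlat stage , Low.Stage.rank stage)
        where stage = Low.stage j j≤h
      ... | no j≰h with j ≤? k
      ...   | yes j≤k = subst (λ F → IsFlat M F × R F ≡ j) (sym (completion-mid j h≤j j≤k))
                          (G-flat (j ℕ.∸ h) i≤ℓ , trans (G-rk (j ℕ.∸ h) i≤ℓ) (ℕP.m+[n∸m]≡n h≤j))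
        where
        h≤j = ℕP.<⇒≤ (ℕP.≰⇒> j≰h)
        i≤ℓ = ℕP.m≤n+o⇒m∸n≤o j h j≤k
      ...   | no j≰k = subst (λ F → IsFlat M F × R F ≡ j) (sym (completion-up j k≤j))
                         (Up.Stage.isFlat stage , trans (Up.Stage.rank stage) (ℕP.m+[n∸m]≡n k≤j))
        where
        k≤j = ℕP.<⇒≤ (ℕP.≰⇒> j≰k)
        stage = Up.stage (j ℕ.∸ k) (subst (_≤ r) (sym (ℕP.m+[n∸m]≡n k≤j)) j≤r)

      completion-⊆ : ∀ j → j < r → completion j ⊆ completion (suc j)
      completion-⊆ j j<r = by-range (suc j ≤? h) (suc j ≤? k)
        where
        -- Case analysis on the range of j, by an argument rather than 'with' so
        -- that the tests inside  completion  are not abstracted.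
        by-range : Dec (suc j ≤ h) → Dec (suc j ≤ k) → completion j ⊆ completion (suc j)
        by-range (yes j<h) _ = subst₂ _⊆_ (sym (completion-low j (ℕP.<⇒≤ j<h))) (sym (completion-low (suc j) j<h))
                                 (StepSpec.above (Low.stage-step j j<h))
        by-range (no 1+j≰h) (yes 1+j≤k) = subst₂ _⊆_ (sym (completion-mid j h≤j (ℕP.<⇒≤ 1+j≤k)))
            (sym (trans (completion-mid (suc j) (ℕP.m≤n⇒m≤1+n h≤j) 1+j≤k) (cong G (ℕP.+-∸-assoc 1 h≤j))))
            (proj₁ (G-⊊ (j ℕ.∸ h) (subst (_≤ ℓ) (ℕP.+-∸-assoc 1 h≤j) (ℕP.m≤n+o⇒m∸n≤o (suc j) h 1+j≤k))))
          where h≤j = ℕP.≤-pred (ℕP.≰⇒> 1+j≰h)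
        by-range (no _) (no 1+j≰k) = subst₂ _⊆_ (sym (completion-up j k≤j))
            (sym (trans (completion-up (suc j) (ℕP.m≤n⇒m≤1+n k≤j)) (cong (climb ⊤ (G ℓ)) (ℕP.+-∸-assoc 1 k≤j))))
            (StepSpec.above (Up.stage-step (j ℕ.∸ k) (subst (_< r) (sym (ℕP.m+[n∸m]≡n k≤j)) j<r)))
          where k≤j = ℕP.≤-pred (ℕP.≰⇒> 1+j≰k)

      completion-⊊ : ∀ j → j < r → completion j ⊊ completion (suc j)
      completion-⊊ j j<r = completion-⊆ j j<r , λ eq → ℕP.1+n≢n (begin
        suc j                    ≡⟨ proj₂ (completion-flat (suc j) j<r) ⟨
        R (completion (suc j))   ≡⟨ cong R eq ⟨
        R (completion j)         ≡⟨ proj₂ (completion-flat j (ℕP.<⇒≤ j<r)) ⟩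
        j                        ∎)
        where open ≡-Reasoning

      member : ∀ i → lookup complete i ≡ completion (suc (toℕ i))
      member = VecP.lookup∘tabulate (λ i → completion (suc (toℕ i)))

      level-complete : ∀ j → j ≤ r → level complete j ≡ completion j
      level-complete zero    _   = sym (completion-low 0 z≤n)
      level-complete (suc j) j<r = trans (level-suc complete j<r)
                                     (trans (member _) (cong (λ t → completion (suc t)) (FinP.toℕ-fromℕ< j<r)))

      complete-chain : IsChain (lookup complete)
      complete-chain = first , consecutive , last
        where
        first : ∀ i → toℕ i ≡ 0 → ⊥ ⊊ lookup complete i
        first i i≡0 = subst₂ _⊊_ (completion-low 0 z≤n) (sym (trans (member i) (cong (λ t → completion (suc t)) i≡0)))
                        (completion-⊊ 0 (subst (_< r) i≡0 (FinP.toℕ<n i)))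
        consecutive : ∀ i j → toℕ j ≡ suc (toℕ i) → lookup complete i ⊊ lookup complete j
        consecutive i j j≡1+i = subst₂ _⊊_ (sym (member i)) (sym (trans (member j) (cong (λ t → completion (suc t)) j≡1+i)))
                                  (completion-⊊ (suc (toℕ i)) (subst (_< r) j≡1+i (FinP.toℕ<n j)))
        last : ∀ i → suc (toℕ i) ≡ r → lookup complete i ≡ ⊤
        last i 1+i≡r = trans (member i) (flat-rank-r (proj₁ top) (trans (proj₂ top) 1+i≡r))
          where top = completion-flat (suc (toℕ i)) (ℕP.≤-reflexive 1+i≡r)

      segment : ∀ (j : Fin (suc ℓ)) → level complete (h ℕ.+ toℕ j) ≡ lookup a j
      segment j = begin
        level complete (h ℕ.+ toℕ j)       ≡⟨ level-complete _ (ℕP.≤-trans h+j≤k k≤r) ⟩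
        completion (h ℕ.+ toℕ j)           ≡⟨ completion-mid _ (ℕP.m≤m+n h _) h+j≤k ⟩
        G (h ℕ.+ toℕ j ℕ.∸ h)              ≡⟨ cong G (ℕP.m+n∸m≡n h (toℕ j)) ⟩
        G (toℕ j)                          ≡⟨ G-lookup j ⟩
        lookup a j                         ∎
        where
        open ≡-Reasoning
        h+j≤k : h ℕ.+ toℕ j ≤ k
        h+j≤k = ℕP.+-monoʳ-≤ h (ℕP.≤-pred (FinP.toℕ<n j))

      restrict-complete : restrict complete ≡ a
      restrict-complete = trans (VecP.tabulate-cong segment) (VecP.tabulate∘lookup a)

      -- Outside the segment the completion follows the canonical rule, since
      -- it was built by the greedy steps that the rule describes.
      complete-canonicalAt : ∀ (j : Fin r) → CanonicalAt complete (toℕ j)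
      complete-canonicalAt j = below-h , above-k
        where
        t = toℕ j
        t<r = FinP.toℕ<n j
        below-h : t < h → Picks (level complete h) (level complete t) (level complete (suc t))
        below-h t<h = picks-cong
          (trans (level-complete h (ℕP.≤-trans (ℕP.m≤m+n h ℓ) k≤r)) (trans (completion-low h ℕP.≤-refl) (Low.climb-end h refl)))
          (trans (level-complete t (ℕP.<⇒≤ t<r)) (completion-low t (ℕP.<⇒≤ t<h)))
          (trans (level-complete (suc t) t<r) (completion-low (suc t) t<h))
          (StepSpec.picks (Low.stage-step t t<h))
        above-k : k ≤ t → Picks ⊤ (level complete t) (level complete (suc t))
        above-k k≤t = picks-cong refl
          (trans (level-complete t (ℕP.<⇒≤ t<r)) (completion-up t k≤t))
          (trans (level-complete (suc t) t<r)
                 (trans (completion-up (suc t) (ℕP.m≤n⇒m≤1+n k≤t)) (cong (climb ⊤ (G ℓ)) (ℕP.+-∸-assoc 1 k≤t))))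
          (StepSpec.picks (Up.stage-step (t ℕ.∸ k) (subst (_< r) (sym (ℕP.m+[n∸m]≡n k≤t)) t<r)))

      complete-canonical : CanonicalFlag complete
      complete-canonical =
        (k≤r , complete-chain , (λ j → trans (cong (λ U → + ∣ U ∣) (segment j)) (proj₂ (proj₂ (proj₁ good j))))
             , complete-canonicalAt)
        , λ i → subst (IsFlat M) (sym (member i)) (proj₁ (completion-flat (suc (toℕ i)) (FinP.toℕ<n i)))

    segments : Correspondence CanonicalFlag (GoodChain M (+ h) ℓ s)
    segments = record
      { forth      = restrict
      ; back       = Completion.complete
      ; forth-ok   = λ _ → restrict-good
      ; back-ok    = λ _ → CompletionSpec.complete-canonical
      ; forth-back = λ _ → CompletionSpec.restrict-complete
      ; back-forth = λ _ flag → canonical-unique (CompletionSpec.complete-canonical (restrict-good flag)) flag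
                                  (CompletionSpec.restrict-complete (restrict-good flag))
      }

    Fhk-counts-flags : Fhk M (+ h) ℓ s ≡ ∑[ b ← allTuples n r ] ind (canonicalFlag? b)
    Fhk-counts-flags = trans (length-filter≡∑ (goodChain? M (+ h) ℓ s) (allTuples n (suc ℓ)))
      (sym (count-correspondence _≟T_ _≟T_ (allTuples n (suc ℓ)) (allTuples n r)
             (allTuples-enumerates n (suc ℓ)) (allTuples-enumerates n r)
             canonicalFlag? (goodChain? M (+ h) ℓ s) segments))

  open InMatroid public using (canonicalFlag?; Fhk-counts-flags)

  -- For a fixed maximal chain b, the number of canonical flags of M equal to
  -- b is the coordinate v_M(b) when b is canonical and 0 otherwise.  Either
  -- way every relation among the vectors v_M annihilates it.
  flag-count-vanishes : (xs : List (ℤ × LoopfreeMatroid r n))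
    → (∀ (C : Fin r → Subset n) → IsChain C → Σℤ xs (λ L → vM (matroid L) C) ≡ 0ℤ)
    → ∀ b → Σℤ xs (λ L → + ind (canonicalFlag? L b)) ≡ 0ℤ
  flag-count-vanishes xs vanish b = by-canonicity (canonical? b)
    where
    by-canonicity : (d : Dec (Canonical b))
      → Σℤ xs (λ L → + ind (d ×-dec FinP.all? (λ i → isFlat? (matroid L) (lookup b i)))) ≡ 0ℤ
    by-canonicity (yes cb@(_ , chain , _)) =
      trans (Σℤ-cong xs (λ L → ind-yes-× cb (FinP.all? (λ i → isFlat? (matroid L) (lookup b i)))))
            (vanish (lookup b) chain)
    by-canonicity (no _) = Σℤ-0 xs

-- No chain of flats has a member of negative rank.
Fhk-negative : ∀ {n} (M : Matroid n) m ℓ s → Fhk M -[1+ m ] ℓ s ≡ 0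
Fhk-negative {n} M m ℓ s =
  trans (length-filter≡∑ (goodChain? M -[1+ m ] ℓ s) (allTuples n (suc ℓ)))
        (∑-zero (allTuples n (suc ℓ)) (λ a → ind-no (goodChain? M -[1+ m ] ℓ s a)
                                               (λ good → negative-rank (proj₁ (proj₂ (proj₁ good zero))))))
  where
  negative-rank : ∀ {x} → + x ≢ -[1+ m ] ℤ.+ + 0
  negative-rank ()

-- The theorem: every relation Σ aᵢ v_{Mᵢ} = 0 gives Σ aᵢ F_{h,k}(Mᵢ; s) = 0.
-- For h ≥ 0, F_{h,k} is a sum over maximal chains of terms each annihilated
-- by the relation; for h < 0 it vanishes.
lemma3p21 : (r n : ℕ) → 1 ≤ r → r ≤ n
    → (h : ℤ) (ℓ : ℕ) (s : Fin (suc ℓ) → ℤ)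
    → (xs : List (ℤ × LoopfreeMatroid r n))
    → (∀ (C : Fin r → Subset n) → IsChain C → Σℤ xs (λ M → vM (matroid M) C) ≡ 0ℤ)
    → Σℤ xs (λ M → + Fhk (matroid M) h ℓ s) ≡ 0ℤ
lemma3p21 r n _ _ (+ h) ℓ s xs vanish = begin
  Σℤ xs (λ L → + Fhk (matroid L) (+ h) ℓ s)
    ≡⟨ Σℤ-cong xs (λ L → cong +_ (Fhk-counts-flags L)) ⟩
  Σℤ xs (λ L → + ∑[ b ← allTuples n r ] ind (canonicalFlag? L b))
    ≡⟨ Σℤ-∑ xs (allTuples n r) _ (flag-count-vanishes xs vanish) ⟩
  0ℤ
    ∎
  where
  open ≡-Reasoning
  open CanonicalChains r n h ℓ s
lemma3p21 r n _ _ -[1+ m ] ℓ s xs _ =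
  trans (Σℤ-cong xs (λ L → cong +_ (Fhk-negative (matroid L) m ℓ s))) (Σℤ-0 xs)
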